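{- Let $(S,U,A,C_1\cup C_2)$ be an instance of WSP, let $\approx_1$ be a plan-indistinguishability relation with respect to $C_1$ and $\approx_2$ a plan-indistinguishability relation with respect to $C_2$. Given an ordering $u_1,\dots,u_n$ of $U$, let $W_1$ be the width of $\approx_1$ (with respect to $C_1$) and $W_2$ the width of $\approx_2$ (with respect to $C_2$) with respect to $u_1,\dots,u_n$. Let $\approx$ be the relation on plans eligible with respect to $C_1\cup C_2$ given by $\pi\approx\pi'$ iff $\pi\approx_1\pi'$ and $\pi\approx_2\pi'$. Then $\approx$ is a plan-indistinguishability relation with respect to $C_1\cup C_2$, and $\approx$ has width at most $W_1W_2$ with respect to $u_1,\dots,u_n$.
   Context: An instance of WSP is a tuple $(S,U,A,C)$: $S$ a finite set of tasks, $U$ a finite set of users ($n=|U|$), $A(s)\subseteq U$ authorization lists, $C$ a set of constraints; a constraint is a pair $(L,\Theta)$ with $L\subseteq S$ and $\Theta$ a set of functions $L\to U$. A plan is a function $\pi:T\to X$ with $T\subseteq S$, $X\subseteq U$, where $\mathrm{task}(\pi)=T$ and $\mathrm{user}(\pi)=X$ are part of the data of $\pi$. $\pi$ satisfies $(L,\Theta)$ if $L\setminus T\neq\emptyset$ or $\pi|_L\in\Theta$; for a set of constraints $C'$, $\pi$ is $C'$-eligible if it satisfies every constraint of $C'$. Plans are disjoint if their task sets are disjoint and their user sets are disjoint; the union $\pi_1\cup\pi_2$ of disjoint plans has the union task and user sets and agrees with $\pi_i$ on $\mathrm{task}(\pi_i)$. $C'$-eligible plans $\pi_1,\pi_2$ are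 extension-equivalent (w.r.t. $C'$) if they have the same user and task sets and for every plan $\pi'$ disjoint from both, $\pi_1\cup\pi'$ is $C'$-eligible iff $\pi_2\cup\pi'$ is. A plan-indistinguishability relation with respect to $C'$ is an equivalence relation on $C'$-eligible plans refining extension-equivalence w.r.t. $C'$ such that if $\pi_1\approx\pi_2$ are $C'$-eligible and $\pi'$ is disjoint from both with $\pi_1\cup\pi'$ $C'$-eligible, then $\pi_1\cup\pi'\approx\pi_2\cup\pi'$. With $U_i=\{u_1,\dots,u_i\}$, the width of a relation $\approx$ on $C'$-eligible plans with respect to $u_1,\dots,u_n$ is the maximum over $i\in[n]$ and $T\subseteq S$ of the number of $\approx$-classes among the $C'$-eligible plans with user set $U_i$ and task set $T$. -}

module Defs where

open import Data.Nat using (ℕ; zero; suc; _≤_; _<ᵇ_)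
open import Data.Fin using (Fin; toℕ)
open import Data.Fin.Subset using (Subset; _∈_; _∉_; _∪_)
open import Data.Bool using (Bool; true; false; T; _∧_; _∨_)
open import Data.Bool.Properties using (T-∧; T-∨)
open import Data.Maybe using (Maybe; just; nothing; is-just)
open import Data.Vec using (Vec; []; _∷_; lookup; map; tabulate; zipWith)
open import Data.Vec.Properties using (lookup-zipWith)
open import Data.List using (List)
open import Data.List.Relation.Unary.All using (All)
open import Data.Product using (Σ; ∃; _×_; _,_; proj₁; proj₂)
open import Data.Sum using (_⊎_; inj₁; inj₂)
open import Data.Empty using (⊥)
open import Function.Bundles using (_⇔_; _↔_; Inverse; Equivalence)
open import Relation.Binary.PropositionalEquality using (_≡_; subst; sym)

-- Tasks S = Fin k, users U = Fin n.
-- A plan π : T → X (T ⊆ S, X ⊆ U) is represented canonically by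
--   * assign : Vec (Maybe (Fin n)) k   (assign[s] = just (π s) for s ∈ T,
--                                        nothing for s ∉ T), so task(π) = T
--     is the support of assign;
--   * users  : Subset n                 the user set X (part of the data,
--                                        not necessarily the image of π);
--   * wf     : a proof (in ⊤, hence unique) that every value lies in X.

wfB : ∀ {k n} → Vec (Maybe (Fin n)) k → Subset n → Bool
wfB []             X = true
wfB (nothing ∷ v)  X = wfB v X
wfB (just u ∷ v)   X = lookup X u ∧ wfB v X

record Plan (k n : ℕ) : Set where
  constructor plan
  field
    assign : Vec (Maybe (Fin n)) k
    users  : Subset n
    wf     : T (wfB assign users)

open Plan public

tasks : ∀ {k n} → Plan k n → Subset k
tasks π = map is-just (assign π)

DisjointSet : ∀ {m} → Subset m → Subset m → Set
DisjointSet p q = ∀ x → x ∈ p → x ∈ q → ⊥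

Disjoint : ∀ {k n} → Plan k n → Plan k n → Set
Disjoint π π' = DisjointSet (tasks π) (tasks π') × DisjointSet (users π) (users π')

-- Union of plans (only meaningful, and only used, for disjoint plans):
-- task set = union of task sets, user set = union of user sets, and it
-- agrees with each πᵢ on task(πᵢ).
mergeM : ∀ {n} → Maybe (Fin n) → Maybe (Fin n) → Maybe (Fin n)
mergeM (just u) _ = just u
mergeM nothing  m = m

private
  T∪ˡ : ∀ {n} (X Y : Subset n) u → T (lookup X u) → T (lookup (X ∪ Y) u)
  T∪ˡ X Y u t = subst T (sym (lookup-zipWith _∨_ u X Y))
                  (Equivalence.from T-∨ (inj₁ t))

  T∪ʳ : ∀ {n} (X Y : Subset n) u → T (lookup Y u) → T (lookup (X ∪ Y) u)
  T∪ʳ X Y u t = subst T (sym (lookup-zipWith _∨_ u X Y))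
                  (Equivalence.from T-∨ (inj₂ t))

  wf-weakˡ : ∀ {k n} (v : Vec (Maybe (Fin n)) k) X Y → T (wfB v X) → T (wfB v (X ∪ Y))
  wf-weakˡ []           X Y t = t
  wf-weakˡ (nothing ∷ v) X Y t = wf-weakˡ v X Y t
  wf-weakˡ (just u ∷ v)  X Y t =
    Equivalence.from T-∧ (T∪ˡ X Y u (proj₁ (Equivalence.to (T-∧ {lookup X u} {wfB v X}) t)) ,
                          wf-weakˡ v X Y (proj₂ (Equivalence.to (T-∧ {lookup X u} {wfB v X}) t)))

  wf-merge : ∀ {k n} (v w : Vec (Maybe (Fin n)) k) X Y →
             T (wfB v X) → T (wfB w Y) → T (wfB (zipWith mergeM v w) (X ∪ Y))
  wf-merge []            []            X Y _ _ = _
  wf-merge (just u ∷ v)  (nothing ∷ w) X Y tv tw =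
    Equivalence.from T-∧ (T∪ˡ X Y u (proj₁ (Equivalence.to (T-∧ {lookup X u} {wfB v X}) tv)) ,
                          wf-merge v w X Y (proj₂ (Equivalence.to (T-∧ {lookup X u} {wfB v X}) tv)) tw)
  wf-merge (just u ∷ v)  (just u' ∷ w) X Y tv tw =
    Equivalence.from T-∧ (T∪ˡ X Y u (proj₁ (Equivalence.to (T-∧ {lookup X u} {wfB v X}) tv)) ,
                          wf-merge v w X Y (proj₂ (Equivalence.to (T-∧ {lookup X u} {wfB v X}) tv))
                            (proj₂ (Equivalence.to (T-∧ {lookup Y u'} {wfB w Y}) tw)))
  wf-merge (nothing ∷ v) (nothing ∷ w) X Y tv tw = wf-merge v w X Y tv tw
  wf-merge (nothing ∷ v) (just u ∷ w)  X Y tv tw =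
    Equivalence.from T-∧ (T∪ʳ X Y u (proj₁ (Equivalence.to (T-∧ {lookup Y u} {wfB w Y}) tw)) ,
                          wf-merge v w X Y tv (proj₂ (Equivalence.to (T-∧ {lookup Y u} {wfB w Y}) tw)))

_∪ₚ_ : ∀ {k n} → Plan k n → Plan k n → Plan k n
π ∪ₚ π' = plan (zipWith mergeM (assign π) (assign π')) (users π ∪ users π')
               (wf-merge (assign π) (assign π') (users π) (users π') (wf π) (wf π'))

-- A constraint (L , Θ) has scope L ⊆ S and a set Θ of
-- functions L → U.  A function L → U is represented canonically as a
-- vector in Vec (Maybe (Fin n)) k with support exactly L; Θ is a
-- predicate on such vectors (its values on vectors with other supports
-- are never consulted).

record Constraint (k n : ℕ) : Set₁ where
  constructor constraint
  field
    scope : Subset k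
    Θ     : Vec (Maybe (Fin n)) k → Set

open Constraint public

-- π|_L  (as a function on L, encoded with support L; used only when L ⊆ task(π))
restrict : ∀ {k n} → Subset k → Plan k n → Vec (Maybe (Fin n)) k
restrict L π = zipWith (λ b m → if′ b m) L (assign π)
  where
  if′ : ∀ {n} → Bool → Maybe (Fin n) → Maybe (Fin n)
  if′ true  m = m
  if′ false m = nothing

Satisfies : ∀ {k n} → Plan k n → Constraint k n → Set
Satisfies π c = (∃ λ s → s ∈ scope c × s ∉ tasks π) ⊎ Θ c (restrict (scope c) π)

Eligible : ∀ {k n} → List (Constraint k n) → Plan k n → Set₁
Eligible C π = All (Satisfies π) C

-- A relation on C'-eligible plans is given as a relation on all plans;
-- only its restriction to C'-eligible plans is ever constrained or used.

ExtEquiv : ∀ {k n} → List (Constraint k n) → Plan k n → Plan k n → Set₁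
ExtEquiv C π₁ π₂ =
  users π₁ ≡ users π₂ × tasks π₁ ≡ tasks π₂ ×
  (∀ π' → Disjoint π₁ π' → Disjoint π₂ π' →
     (Eligible C (π₁ ∪ₚ π') ⇔ Eligible C (π₂ ∪ₚ π')))

record IsPlanIndist {k n} (C : List (Constraint k n))
                    (_≈_ : Plan k n → Plan k n → Set) : Set₁ where
  field
    refl′  : ∀ π → Eligible C π → π ≈ π
    sym′   : ∀ π₁ π₂ → Eligible C π₁ → Eligible C π₂ → π₁ ≈ π₂ → π₂ ≈ π₁
    trans′ : ∀ π₁ π₂ π₃ → Eligible C π₁ → Eligible C π₂ → Eligible C π₃ →
             π₁ ≈ π₂ → π₂ ≈ π₃ → π₁ ≈ π₃
    refines : ∀ π₁ π₂ → Eligible C π₁ → Eligible C π₂ → π₁ ≈ π₂ → ExtEquiv C π₁ π₂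
    extend : ∀ π₁ π₂ π' → Eligible C π₁ → Eligible C π₂ → π₁ ≈ π₂ →
             Disjoint π₁ π' → Disjoint π₂ π' → Eligible C (π₁ ∪ₚ π') →
             (π₁ ∪ₚ π') ≈ (π₂ ∪ₚ π')

-- Width.  The ordering u₁,…,uₙ of U is a bijection σ : Fin n ↔ Fin n,
-- uⱼ₊₁ = to σ j.  Uᵢ = {u₁,…,uᵢ} = {x | toℕ (from σ x) < i}.

Uprefix : ∀ {n} → (Fin n ↔ Fin n) → ℕ → Subset n
Uprefix σ i = tabulate (λ x → toℕ (Inverse.from σ x) <ᵇ i)

-- "The C-eligible plans satisfying P fall into at most W classes of ≈":
-- there is a map f into Fin W which, on such plans, satisfies
-- π ≈ π' ⇔ f π ≡ f π' (i.e. an injection of the set of classes into Fin W).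
ClassesAtMost : ∀ {k n} → List (Constraint k n) → (Plan k n → Plan k n → Set) →
                (Plan k n → Set) → ℕ → Set₁
ClassesAtMost {k} {n} C _≈_ P W =
  Σ (Plan k n → Fin W) λ f →
    ∀ π π' → Eligible C π → P π → Eligible C π' → P π' →
      (π ≈ π' ⇔ f π ≡ f π')

WidthAtMost : ∀ {k n} → List (Constraint k n) → (Plan k n → Plan k n → Set) →
              (Fin n ↔ Fin n) → ℕ → Set₁
WidthAtMost {k} {n} C _≈_ σ W =
  ∀ (i : ℕ) → 1 ≤ i → i ≤ n → (Tk : Subset k) →
    ClassesAtMost C _≈_ (λ π → users π ≡ Uprefix σ i × tasks π ≡ Tk) W

IsWidth : ∀ {k n} → List (Constraint k n) → (Plan k n → Plan k n → Set) →
          (Fin n ↔ Fin n) → ℕ → Set₁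
IsWidth C _≈_ σ W = WidthAtMost C _≈_ σ W × (∀ W' → WidthAtMost C _≈_ σ W' → W ≤ W')

-- WSP instance (S , U , A , C): S = Fin k, U = Fin n, A : S → 𝒫(U).
-- (A plays no role in the notions above, exactly as in the paper.)
Authorization : ℕ → ℕ → Set
Authorization k n = Fin k → Subset n

-- Eligibility for C₁ ++ C₂ is eligibility for C₁ together with eligibility
-- for C₂, so every axiom of a plan-indistinguishability relation holds for
-- ≈₁ ∩ ≈₂ componentwise.  A class of ≈₁ ∩ ≈₂ is determined by a pair of a
-- ≈₁-class and a ≈₂-class; pairing the two class indices with combine gives
-- an injection of the classes into Fin (W₁ * W₂).
module Submission where

open import Defs
open import Data.Nat using (ℕ; _*_)
open import Data.Fin using (Fin; combine)
open import Data.Fin.Properties using (combine-injective)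
open import Data.List using (List; _++_)
open import Data.List.Relation.Unary.All.Properties using (++⁺; ++⁻ˡ; ++⁻ʳ)
open import Data.Product using (_×_; _,_; proj₁)
open import Function.Bundles using (_↔_; _⇔_; Equivalence; mk⇔)
open import Relation.Binary.Construct.Intersection using (_∩_)
open import Relation.Binary.PropositionalEquality using (cong₂)

open Equivalence using (to; from)

module _ {k n : ℕ} (C₁ C₂ : List (Constraint k n)) where

  Eligible-++⁻ˡ : ∀ π → Eligible (C₁ ++ C₂) π → Eligible C₁ π
  Eligible-++⁻ˡ π = ++⁻ˡ {P = Satisfies π} C₁

  Eligible-++⁻ʳ : ∀ π → Eligible (C₁ ++ C₂) π → Eligible C₂ π
  Eligible-++⁻ʳ π = ++⁻ʳ {P = Satisfies π} C₁

  Eligible-++-cong : ∀ {π π'} →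
                     Eligible C₁ π ⇔ Eligible C₁ π' → Eligible C₂ π ⇔ Eligible C₂ π' →
                     Eligible (C₁ ++ C₂) π ⇔ Eligible (C₁ ++ C₂) π'
  Eligible-++-cong {π} {π'} h₁ h₂ =
    mk⇔ (λ e → ++⁺ (to   h₁ (Eligible-++⁻ˡ π  e)) (to   h₂ (Eligible-++⁻ʳ π  e)))
        (λ e → ++⁺ (from h₁ (Eligible-++⁻ˡ π' e)) (from h₂ (Eligible-++⁻ʳ π' e)))

  ExtEquiv-++ : ∀ {π₁ π₂} → ExtEquiv C₁ π₁ π₂ → ExtEquiv C₂ π₁ π₂ →
                ExtEquiv (C₁ ++ C₂) π₁ π₂
  ExtEquiv-++ {π₁} {π₂} (users≡ , tasks≡ , ext₁) (_ , _ , ext₂) =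
    users≡ , tasks≡ , λ π' d₁ d₂ →
      Eligible-++-cong {π₁ ∪ₚ π'} {π₂ ∪ₚ π'} (ext₁ π' d₁ d₂) (ext₂ π' d₁ d₂)

  module _ (_≈₁_ _≈₂_ : Plan k n → Plan k n → Set) where

    IsPlanIndist-∩ : IsPlanIndist C₁ _≈₁_ → IsPlanIndist C₂ _≈₂_ →
                     IsPlanIndist (C₁ ++ C₂) (_≈₁_ ∩ _≈₂_)
    IsPlanIndist-∩ I₁ I₂ = record
      { refl′   = λ π e → I₁.refl′ π (ˡ π e) , I₂.refl′ π (ʳ π e)
      ; sym′    = λ π₁ π₂ e₁ e₂ (r₁ , r₂) →
          I₁.sym′ π₁ π₂ (ˡ π₁ e₁) (ˡ π₂ e₂) r₁ , I₂.sym′ π₁ π₂ (ʳ π₁ e₁) (ʳ π₂ e₂) r₂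
      ; trans′  = λ π₁ π₂ π₃ e₁ e₂ e₃ (r₁ , r₂) (s₁ , s₂) →
          I₁.trans′ π₁ π₂ π₃ (ˡ π₁ e₁) (ˡ π₂ e₂) (ˡ π₃ e₃) r₁ s₁ ,
          I₂.trans′ π₁ π₂ π₃ (ʳ π₁ e₁) (ʳ π₂ e₂) (ʳ π₃ e₃) r₂ s₂
      ; refines = λ π₁ π₂ e₁ e₂ (r₁ , r₂) →
          ExtEquiv-++ {π₁} {π₂} (I₁.refines π₁ π₂ (ˡ π₁ e₁) (ˡ π₂ e₂) r₁)
                      (I₂.refines π₁ π₂ (ʳ π₁ e₁) (ʳ π₂ e₂) r₂)
      ; extend  = λ π₁ π₂ π' e₁ e₂ (r₁ , r₂) d₁ d₂ e →
          I₁.extend π₁ π₂ π' (ˡ π₁ e₁) (ˡ π₂ e₂) r₁ d₁ d₂ (ˡ (π₁ ∪ₚ π') e) ,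
          I₂.extend π₁ π₂ π' (ʳ π₁ e₁) (ʳ π₂ e₂) r₂ d₁ d₂ (ʳ (π₁ ∪ₚ π') e)
      }
      where
      module I₁ = IsPlanIndist I₁
      module I₂ = IsPlanIndist I₂
      ˡ : ∀ π → Eligible (C₁ ++ C₂) π → Eligible C₁ π
      ˡ = Eligible-++⁻ˡ
      ʳ : ∀ π → Eligible (C₁ ++ C₂) π → Eligible C₂ π
      ʳ = Eligible-++⁻ʳ

    ClassesAtMost-∩ : ∀ {P : Plan k n → Set} {W₁ W₂ : ℕ} →
                      ClassesAtMost C₁ _≈₁_ P W₁ → ClassesAtMost C₂ _≈₂_ P W₂ →
                      ClassesAtMost (C₁ ++ C₂) (_≈₁_ ∩ _≈₂_) P (W₁ * W₂)
    ClassesAtMost-∩ (f₁ , classes₁) (f₂ , classes₂) =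
      (λ π → combine (f₁ π) (f₂ π)) , λ π π' e p e' p' →
        let c₁ = classes₁ π π' (Eligible-++⁻ˡ π e) p (Eligible-++⁻ˡ π' e') p'
            c₂ = classes₂ π π' (Eligible-++⁻ʳ π e) p (Eligible-++⁻ʳ π' e') p'
        in mk⇔ (λ (r₁ , r₂) → cong₂ combine (to c₁ r₁) (to c₂ r₂))
               (λ eq → let (q₁ , q₂) = combine-injective (f₁ π) (f₂ π) (f₁ π') (f₂ π') eq
                       in from c₁ q₁ , from c₂ q₂)

    WidthAtMost-∩ : ∀ (σ : Fin n ↔ Fin n) {W₁ W₂ : ℕ} →
                    WidthAtMost C₁ _≈₁_ σ W₁ → WidthAtMost C₂ _≈₂_ σ W₂ →
                    WidthAtMost (C₁ ++ C₂) (_≈₁_ ∩ _≈₂_) σ (W₁ * W₂)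
    WidthAtMost-∩ σ w₁ w₂ i 1≤i i≤n Tk = ClassesAtMost-∩ (w₁ i 1≤i i≤n Tk) (w₂ i 1≤i i≤n Tk)

theorem21 : ∀ {k n} (A : Authorization k n) (C₁ C₂ : List (Constraint k n))
    (_≈₁_ _≈₂_ : Plan k n → Plan k n → Set) →
    IsPlanIndist C₁ _≈₁_ → IsPlanIndist C₂ _≈₂_ →
    (σ : Fin n ↔ Fin n) (W₁ W₂ : ℕ) →
    IsWidth C₁ _≈₁_ σ W₁ → IsWidth C₂ _≈₂_ σ W₂ →
    IsPlanIndist (C₁ ++ C₂) (λ π π' → π ≈₁ π' × π ≈₂ π') ×
    WidthAtMost (C₁ ++ C₂) (λ π π' → π ≈₁ π' × π ≈₂ π') σ (W₁ * W₂)
theorem21 _ C₁ C₂ _≈₁_ _≈₂_ I₁ I₂ σ _ _ width₁ width₂ =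
  IsPlanIndist-∩ C₁ C₂ _≈₁_ _≈₂_ I₁ I₂ ,
  WidthAtMost-∩ C₁ C₂ _≈₁_ _≈₂_ σ (proj₁ width₁) (proj₁ width₂)
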